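{- Fix an integer $m>1$ and an instance of the Minimum Cost Markov Chain problem as described in the context. Let $i\in\{0,1,\ldots,m-1\}$, let $S_i\in\mathbb{S}_i$, and let $\mathbf u,\mathbf v\in\mathbb{R}^{m-1}$ with $\mathbf u\neq\mathbf v$ and $\mathbf v-\mathbf u\in C_i$. Then $f_i(\mathbf v,S_i)\le f_i(\mathbf u,S_i)$. Moreover, if $i\neq 0$, then $f_i(\mathbf v,S_i)< f_i(\mathbf u,S_i)$.
   Context: Fix an integer $m>1$. For each $k\in\{0,\ldots,m-1\}$ let $\mathbb{S}_k$ be a finite nonempty set ("permissible states of type $k$"). Each $S\in\mathbb{S}_k$ has a real cost $\ell(S)\ge 0$ and transition probabilities $q_0(S),\ldots,q_{m-1}(S)\ge 0$ with $\sum_{j=0}^{m-1}q_j(S)=1$ and $q_0(S)>0$. For $\mathbf x=(x_1,\ldots,x_{m-1})\in\mathbb{R}^{m-1}$ define $f_0(\mathbf x,S)=\ell(S)+\sum_{j=1}^{m-1}q_j(S)x_j$ for $S\in\mathbb{S}_0$, and for $k\ge 1$, $f_k(\mathbf x,S)=\ell(S)+\sum_{j=1}^{m-1}q_j(S)x_j-x_k$ for $S\in\mathbb{S}_k$. Define the sets $C_0=\{\mathbf u\in\mathbb{R}^{m-1}: u_j\le 0\text{ for all }j\}$ and, for $k\in\{1,\ldots,m-1\}$, $C_k=\{\mathbf u\in\mathbb{R}^{m-1}: u_k>0\text{ and } u_k\ge u_j\text{ for all } j\}$. -}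

module Defs where

open import Level using (Level; _⊔_; Lift)
open import Data.Nat using (ℕ; zero; suc) renaming (_<_ to _<ℕ_)
open import Data.Fin using (Fin; zero; suc)
open import Data.Product using (_×_)
open import Relation.Nullary using (¬_)
open import Algebra.Bundles using (CommutativeRing)
open import Relation.Binary.Structures using (IsTotalOrder)

-- The statement is
-- formulated over an arbitrary totally ordered commutative ring (ℝ is one),
-- which is a generalisation of the real-number statement.
record OrderedCommRing (c ℓ₁ ℓ₂ : Level) : Set (Level.suc (c ⊔ ℓ₁ ⊔ ℓ₂)) where
  field
    commutativeRing : CommutativeRing c ℓ₁
  open CommutativeRing commutativeRing public
  infix 4 _≤_ _<_
  field
    _≤_          : Carrier → Carrier → Set ℓ₂
    isTotalOrder : IsTotalOrder _≈_ _≤_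
  _<_ : Carrier → Carrier → Set (ℓ₁ ⊔ ℓ₂)
  a < b = (a ≤ b) × ¬ (a ≈ b)
  field
    +-mono-≤   : ∀ {a b} c → a ≤ b → a + c ≤ b + c
    *-nonneg   : ∀ {a b} → 0# ≤ a → 0# ≤ b → 0# ≤ a * b
    *-pos      : ∀ {a b} → 0# < a → 0# < b → 0# < a * b

module _ {c ℓ₁ ℓ₂} (R : OrderedCommRing c ℓ₁ ℓ₂) where
  open OrderedCommRing R using (Carrier; _≈_; _≤_; _<_; _+_; _*_; _-_; 0#; 1#)

  Σ : ∀ {n} → (Fin n → Carrier) → Carrier
  Σ {zero}  f = 0#
  Σ {suc n} f = f zero + Σ (λ j → f (suc j))

  -- An instance of the Minimum Cost Markov Chain problem with m = suc n.  Vectors x ∈ ℝ^{m-1} are Fin n → Carrier,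
  -- where coordinate x_j (1 ≤ j ≤ m-1) is x (j-1).  Transition probability
  -- q_j(S) is prob k S j for j : Fin (suc n).
  record Instance (n : ℕ) : Set (c ⊔ ℓ₁ ⊔ ℓ₂) where
    field
      size      : Fin (suc n) → ℕ
      nonempty  : ∀ k → 0 <ℕ size k
      cost      : (k : Fin (suc n)) → Fin (size k) → Carrier
      cost-nonneg : ∀ k S → 0# ≤ cost k S
      prob      : (k : Fin (suc n)) → Fin (size k) → Fin (suc n) → Carrier
      prob-nonneg : ∀ k S j → 0# ≤ prob k S j
      prob-sum  : ∀ k S → Σ (prob k S) ≈ 1#
      prob0-pos : ∀ k S → 0# < prob k S zero

  module _ {n : ℕ} (I : Instance n) where
    open Instance I

    base : (k : Fin (suc n)) → Fin (size k) → (Fin n → Carrier) → Carrier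
    base k S x = cost k S + Σ (λ j → prob k S (suc j) * x j)

    f : (k : Fin (suc n)) → (Fin n → Carrier) → Fin (size k) → Carrier
    f zero    x S = base zero S x
    f (suc k) x S = base (suc k) S x - x k

  InC : ∀ {n} → Fin (suc n) → (Fin n → Carrier) → Set (ℓ₁ ⊔ ℓ₂)
  InC zero    w = Lift ℓ₁ (∀ j → w j ≤ 0#)
  InC (suc k) w = (0# < w k) × (∀ j → w j ≤ w k)

  _⊖_ : ∀ {n} → (Fin n → Carrier) → (Fin n → Carrier) → (Fin n → Carrier)
  (v ⊖ u) j = v j - u j

{-# OPTIONS --safe #-}
-- For fixed S, f_i(·, S) is the affine map x ↦ ℓ(S) + Σ_j q_j(S) x_j (− x_i if i ≥ 1)
-- with nonnegative weights.  On C_0 every coordinate decreases, so f_0 does not increase.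
-- On C_i (i ≥ 1) every coordinate grows by at most d = v_i − u_i > 0, so the weighted
-- sum grows by at most (1 − q_0(S)) d while the subtracted x_i grows by exactly d;
-- since q_0(S) d > 0, f_i strictly decreases.
module Submission where

open import Defs
open import Data.Nat using (ℕ; zero; suc)
open import Data.Fin using (Fin; zero; suc)
open import Data.Product using (_×_; _,_; proj₁)
open import Function using (_∘_)
open import Level using (lift)
open import Relation.Nullary using (¬_; contradiction)
open import Relation.Binary.Bundles using (Poset)
open import Relation.Binary.Structures using (IsTotalOrder)
open import Relation.Binary.PropositionalEquality using (_≡_; _≢_)
import Relation.Binary.PropositionalEquality as ≡
import Algebra.Properties.AbelianGroup as AbelianGroupProperties
import Algebra.Properties.Semiring.Sum as SemiringSum
import Relation.Binary.Reasoning.PartialOrder as PartialOrderReasoning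

module OrderedCommRingProperties {c ℓ₁ ℓ₂} (R : OrderedCommRing c ℓ₁ ℓ₂) where
  open OrderedCommRing R hiding (zero)
  open IsTotalOrder isTotalOrder using (isPartialOrder)
  open AbelianGroupProperties +-abelianGroup using (//-rightDividesˡ; ∙-cancelʳ; xyx⁻¹≈y)

  poset : Poset c ℓ₁ ℓ₂
  poset = record { isPartialOrder = isPartialOrder }

  open PartialOrderReasoning poset

  +-monoʳ-≤ : ∀ a {x y} → x ≤ y → a + x ≤ a + y
  +-monoʳ-≤ a {x} {y} x≤y = begin
    a + x  ≈⟨ +-comm a x ⟩
    x + a  ≤⟨ +-mono-≤ a x≤y ⟩
    y + a  ≈⟨ +-comm y a ⟩
    a + y  ∎

  +-mono-≤₂ : ∀ {a b x y} → a ≤ b → x ≤ y → a + x ≤ b + y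
  +-mono-≤₂ {a} {b} {x} {y} a≤b x≤y = begin
    a + x  ≤⟨ +-mono-≤ x a≤b ⟩
    b + x  ≤⟨ +-monoʳ-≤ b x≤y ⟩
    b + y  ∎

  +-monoˡ-< : ∀ a {x y} → x < y → x + a < y + a
  +-monoˡ-< a {x} {y} (x≤y , x≉y) = +-mono-≤ a x≤y , x≉y ∘ ∙-cancelʳ a x y

  +-monoʳ-< : ∀ a {x y} → x < y → a + x < a + y
  +-monoʳ-< a {x} {y} x<y = begin-strict
    a + x  ≈⟨ +-comm a x ⟩
    x + a  <⟨ +-monoˡ-< a x<y ⟩
    y + a  ≈⟨ +-comm y a ⟩
    a + y  ∎

  x<y+x : ∀ x {y} → 0# < y → x < y + x
  x<y+x x {y} 0<y = begin-strict
    x       ≈⟨ +-identityˡ x ⟨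
    0# + x  <⟨ +-monoˡ-< x 0<y ⟩
    y + x   ∎

  x-y≤z⇒x≤y+z : ∀ {x y z} → x - y ≤ z → x ≤ y + z
  x-y≤z⇒x≤y+z {x} {y} {z} x-y≤z = begin
    x            ≈⟨ //-rightDividesˡ y x ⟨
    (x - y) + y  ≤⟨ +-mono-≤ y x-y≤z ⟩
    z + y        ≈⟨ +-comm z y ⟩
    y + z        ∎

  *-monoˡ-≤-nonNeg : ∀ {a x y} → 0# ≤ a → x ≤ y → a * x ≤ a * y
  *-monoˡ-≤-nonNeg {a} {x} {y} 0≤a x≤y = begin
    a * x                  ≈⟨ +-identityˡ (a * x) ⟨
    0# + a * x             ≤⟨ +-mono-≤ (a * x) (*-nonneg 0≤a 0≤y-x) ⟩
    a * (y - x) + a * x    ≈⟨ distribˡ a (y - x) x ⟨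
    a * ((y - x) + x)      ≈⟨ *-congˡ (//-rightDividesˡ x y) ⟩
    a * y                  ∎
    where
    0≤y-x : 0# ≤ y - x
    0≤y-x = begin
      0#     ≈⟨ -‿inverseʳ x ⟨
      x - x  ≤⟨ +-mono-≤ (- x) x≤y ⟩
      y - x  ∎

  x<y+[a-b]⇒x-a<y-b : ∀ {x y a b} → x < y + (a - b) → x - a < y - b
  x<y+[a-b]⇒x-a<y-b {x} {y} {a} {b} x<y+[a-b] = begin-strict
    x - a                <⟨ +-monoˡ-< (- a) x<y+[a-b] ⟩
    (y + (a - b)) - a    ≈⟨ +-assoc y (a - b) (- a) ⟩
    y + ((a - b) - a)    ≈⟨ +-congˡ (xyx⁻¹≈y a (- b)) ⟩
    y - b                ∎

  p+t≈1⇒t*d<d : ∀ {p t d} → 0# < p → p + t ≈ 1# → 0# < d → t * d < d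
  p+t≈1⇒t*d<d {p} {t} {d} 0<p p+t≈1 0<d = begin-strict
    t * d          <⟨ x<y+x (t * d) (*-pos 0<p 0<d) ⟩
    p * d + t * d  ≈⟨ distribʳ d p t ⟨
    (p + t) * d    ≈⟨ *-congʳ p+t≈1 ⟩
    1# * d         ≈⟨ *-identityˡ d ⟩
    d              ∎

module WeightedSum {c ℓ₁ ℓ₂} (R : OrderedCommRing c ℓ₁ ℓ₂) where
  open OrderedCommRing R hiding (zero)
  open IsTotalOrder isTotalOrder using () renaming (refl to ≤-refl)
  open OrderedCommRingProperties R
  open SemiringSum semiring using (sum; sum-cong-≋; ∑-distrib-+; *-distribʳ-sum)
  open PartialOrderReasoning poset

  Σ≡sum : ∀ {n} (x : Fin n → Carrier) → Σ R x ≡ sum x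
  Σ≡sum {zero}  x = ≡.refl
  Σ≡sum {suc n} x = ≡.cong (x zero +_) (Σ≡sum (x ∘ suc))

  Σ-mono-≤ : ∀ {n} {x y : Fin n → Carrier} → (∀ j → x j ≤ y j) → Σ R x ≤ Σ R y
  Σ-mono-≤ {zero}  x≤y = ≤-refl
  Σ-mono-≤ {suc n} x≤y = +-mono-≤₂ (x≤y zero) (Σ-mono-≤ (x≤y ∘ suc))

  infix 7 _·_
  _·_ : ∀ {n} → (Fin n → Carrier) → (Fin n → Carrier) → Carrier
  q · x = Σ R (λ j → q j * x j)

  ·-monoʳ-≤ : ∀ {n} {q x y : Fin n → Carrier} →
              (∀ j → 0# ≤ q j) → (∀ j → x j ≤ y j) → q · x ≤ q · y
  ·-monoʳ-≤ 0≤q x≤y = Σ-mono-≤ (λ j → *-monoˡ-≤-nonNeg (0≤q j) (x≤y j))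

  ·-shift : ∀ {n} (q x : Fin n → Carrier) d → q · (λ j → x j + d) ≈ q · x + Σ R q * d
  ·-shift {n} q x d = begin-equality
    q · (λ j → x j + d)              ≡⟨ Σ≡sum (λ j → q j * (x j + d)) ⟩
    sum (λ j → q j * (x j + d))      ≈⟨ sum-cong-≋ (λ j → distribˡ (q j) (x j) d) ⟩
    sum (λ j → q j * x j + q j * d)  ≈⟨ ∑-distrib-+ (λ j → q j * x j) (λ j → q j * d) ⟩
    sum qx + sum (λ j → q j * d)     ≈⟨ +-congˡ (*-distribʳ-sum d q) ⟨
    sum qx + sum q * d               ≡⟨ ≡.cong₂ (λ a b → a + b * d) (Σ≡sum qx) (Σ≡sum q) ⟨
    q · x + Σ R q * d                ∎
    where
    qx : Fin n → Carrier
    qx j = q j * x j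

  ·-shift-< : ∀ {n} {q x y : Fin n → Carrier} {p d} →
              (∀ j → 0# ≤ q j) → 0# < p → p + Σ R q ≈ 1# →
              0# < d → (∀ j → y j ≤ x j + d) → q · y < q · x + d
  ·-shift-< {q = q} {x} {y} {p} {d} 0≤q 0<p p+Σq≈1 0<d y≤x+d = begin-strict
    q · y                ≤⟨ ·-monoʳ-≤ 0≤q y≤x+d ⟩
    q · (λ j → x j + d)  ≈⟨ ·-shift q x d ⟩
    q · x + Σ R q * d    <⟨ +-monoʳ-< (q · x) (p+t≈1⇒t*d<d 0<p p+Σq≈1 0<d) ⟩
    q · x + d            ∎

module MinimumCostMarkovChain {c ℓ₁ ℓ₂} (R : OrderedCommRing c ℓ₁ ℓ₂) {n} (I : Instance R n) where
  open OrderedCommRing R hiding (zero)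
  open OrderedCommRingProperties R
  open WeightedSum R
  open Instance I
  open PartialOrderReasoning poset

  f-zero-antitone : ∀ S {u v} → InC R zero (_⊖_ R v u) → f R I zero v S ≤ f R I zero u S
  f-zero-antitone S {u} {v} (lift v-u≤0) =
    +-monoʳ-≤ (cost zero S) (·-monoʳ-≤ (λ j → prob-nonneg zero S (suc j)) v≤u)
    where
    v≤u : ∀ j → v j ≤ u j
    v≤u j = begin
      v j       ≤⟨ x-y≤z⇒x≤y+z (v-u≤0 j) ⟩
      u j + 0#  ≈⟨ +-identityʳ (u j) ⟩
      u j       ∎

  f-suc-decreasing : ∀ k S {u v} → InC R (suc k) (_⊖_ R v u) → f R I (suc k) v S < f R I (suc k) u S
  f-suc-decreasing k S {u} {v} (0<d , v-u≤d) = x<y+[a-b]⇒x-a<y-b (begin-strict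
    cost i S + q · v        <⟨ +-monoʳ-< (cost i S) q·v<q·u+d ⟩
    cost i S + (q · u + d)  ≈⟨ +-assoc (cost i S) (q · u) d ⟨
    cost i S + q · u + d    ∎)
    where
    i : Fin (suc n)
    i = suc k
    q : Fin n → Carrier
    q j = prob i S (suc j)
    d : Carrier
    d = v k - u k
    q·v<q·u+d : q · v < q · u + d
    q·v<q·u+d = ·-shift-< (λ j → prob-nonneg i S (suc j)) (prob0-pos i S) (prob-sum i S) 0<d
                          (λ j → x-y≤z⇒x≤y+z (v-u≤d j))

open import Data.Nat using (_≤_)
open MinimumCostMarkovChain using (f-zero-antitone; f-suc-decreasing)

lemma1 : ∀ {c ℓ₁ ℓ₂} (R : OrderedCommRing c ℓ₁ ℓ₂) (n : ℕ) → 1 ≤ n →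
         (I : Instance R n) (i : Fin (suc n)) (S : Fin (Instance.size I i))
         (u v : Fin n → OrderedCommRing.Carrier R) →
         ¬ (∀ j → OrderedCommRing._≈_ R (u j) (v j)) →
         InC R i (_⊖_ R v u) →
         OrderedCommRing._≤_ R (f R I i v S) (f R I i u S)
         × (i ≢ zero → OrderedCommRing._<_ R (f R I i v S) (f R I i u S))
lemma1 R n _ I zero    S u v _ v-u∈C₀ = f-zero-antitone R I S v-u∈C₀ , λ 0≢0 → contradiction ≡.refl 0≢0
lemma1 R n _ I (suc k) S u v _ v-u∈Cₖ = proj₁ fv<fu , λ _ → fv<fu
  where
  fv<fu : OrderedCommRing._<_ R (f R I (suc k) v S) (f R I (suc k) u S)
  fv<fu = f-suc-decreasing R I k S v-u∈Cₖ
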